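{- Let $(a,b,c,r,s;x_1,y_1,\dots,x_N,y_N)$ be a set of solutions with $\gcd(a,b)>1$ and $\min(x_1,\dots,x_N)=\min(y_1,\dots,y_N)=0$. Suppose it is not in the same family as a subset (or an associate of a subset) of any of $(3,3,2,1,1;0,0,0,1,1,0)$, $(5,2,3,1,2;0,0,0,1,1,0,1,2,3,6)$, $(2,2,5,1,3;0,1,1,0,3,0)$, $(2,2,3,1,1;0,1,0,2,1,0,2,0)$. Then, after relabeling the pairs, $x_1=y_1=0$ and $x_i>0$, $y_i>0$ for all $i>1$.
   Context: For integers $a>1$, $b>1$, $c>0$, $r>0$, $s>0$, a solution of $(-1)^u r a^x + (-1)^v s b^y = c$ is a quadruple $(x,y,u,v)$ with $x,y$ nonnegative integers and $u,v\in\{0,1\}$; it is referred to by the pair $(x,y)$. A set of solutions $(a,b,c,r,s;x_1,y_1,\dots,x_N,y_N)$ is the unordered set of $N>2$ distinct pairs $(x_i,y_i)$, each a solution for the given $a,b,c,r,s$. Two sets of solutions $(a,b,c,r,s;x_1,y_1,\dots,x_N,y_N)$ and $(A,B,C,R,S;X_1,Y_1,\dots,X_N,Y_N)$ are in the same family if $a$ and $A$ are both powers of one integer, $b$ and $B$ are both powers of one integer, and there is a positive rational $k$ with $kc=C$ such that for every $i$ there is $j$ with $kra^{x_i}=RA^{X_j}$ and $ksb^{y_i}=SB^{Y_j}$. A subset of a set of solutions is any set of solutions (at least three pairs) with the same $a,b,c,r,s$ all of whose pairs are among the given ones. The associate of $(a,b,c,r,s;x_1,y_1,\dots,x_N,y_N)$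 is $(b,a,c,s,r;y_1,x_1,\dots,y_N,x_N)$. -}

module Defs where

open import Data.Nat using (ℕ; _≤_; _<_; _*_; _^_)
open import Data.Integer as ℤ using (ℤ; +_; -[1+_])
open import Data.Product using (_×_; _,_; ∃; ∃-syntax; Σ-syntax; proj₁; proj₂; swap)
open import Data.List using (List; []; _∷_; length; map)
open import Data.List.Relation.Unary.All using (All)
open import Data.List.Relation.Unary.Any using (Any)
open import Data.List.Relation.Unary.Unique.Propositional using (Unique)
open import Data.List.Membership.Propositional using (_∈_)
open import Relation.Binary.PropositionalEquality using (_≡_)
open import Relation.Nullary using (¬_)

Pair : Set
Pair = ℕ × ℕ

IsSolution : (a b c r s : ℕ) → Pair → Set
IsSolution a b c r s (x , y) =
  ∃[ u ] ∃[ v ] (u ≤ 1 × v ≤ 1 ×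
    (-[1+ 0 ] ℤ.^ u) ℤ.* (+ r) ℤ.* ((+ a) ℤ.^ x)
      ℤ.+ (-[1+ 0 ] ℤ.^ v) ℤ.* (+ s) ℤ.* ((+ b) ℤ.^ y) ≡ + c)

record Tuple : Set where
  constructor tuple
  field
    a b c r s : ℕ
    pairs : List Pair
open Tuple public

IsSetOfSolutions : Tuple → Set
IsSetOfSolutions T =
  Unique (pairs T) × 3 ≤ length (pairs T)
    × All (IsSolution (a T) (b T) (c T) (r T) (s T)) (pairs T)

PowersOfOne : ℕ → ℕ → Set
PowersOfOne x y = ∃[ t ] ∃[ m ] ∃[ n ] (x ≡ t ^ m × y ≡ t ^ n)

-- same family; the positive rational k is written as k = p / q with p, q > 0
SameFamily : Tuple → Tuple → Set
SameFamily T U =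
  PowersOfOne (a T) (a U) × PowersOfOne (b T) (b U)
    × length (pairs T) ≡ length (pairs U)
    × ∃[ p ] ∃[ q ] (0 < p × 0 < q × p * c T ≡ q * c U
        × All (λ xy → Any (λ XY →
              (p * r T * a T ^ proj₁ xy ≡ q * r U * a U ^ proj₁ XY)
            × (p * s T * b T ^ proj₂ xy ≡ q * s U * b U ^ proj₂ XY))
            (pairs U)) (pairs T))

IsSubsetOf : Tuple → Tuple → Set
IsSubsetOf T U =
  a T ≡ a U × b T ≡ b U × c T ≡ c U × r T ≡ r U × s T ≡ s U
    × IsSetOfSolutions T × All (_∈ pairs U) (pairs T)

associate : Tuple → Tuple
associate (tuple a b c r s ps) = tuple b a c s r (map swap ps)

exceptional : List Tuple
exceptional =
    tuple 3 3 2 1 1 ((0 , 0) ∷ (0 , 1) ∷ (1 , 0) ∷ [])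
  ∷ tuple 5 2 3 1 2 ((0 , 0) ∷ (0 , 1) ∷ (1 , 0) ∷ (1 , 2) ∷ (3 , 6) ∷ [])
  ∷ tuple 2 2 5 1 3 ((0 , 1) ∷ (1 , 0) ∷ (3 , 0) ∷ [])
  ∷ tuple 2 2 3 1 1 ((0 , 1) ∷ (0 , 2) ∷ (1 , 0) ∷ (2 , 0) ∷ [])
  ∷ []

NotExceptional : Tuple → Set
NotExceptional T = ∀ E → E ∈ exceptional → ∀ U → IsSubsetOf U E →
  ¬ SameFamily T U × ¬ SameFamily T (associate U)

{-# OPTIONS --safe #-}
module Submission where

-- Let d > 1 divide a and b. If d divides r and s, it divides c too (look at any solution), and
-- dividing c, r, s by d leaves a set of solutions of the same kind; so by descent d ∤ r or d ∤ s.
-- A solution (x, y) with x, y > 0 would force d ∣ c, and each configuration to be excluded (the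
-- origin with a second point on an axis, or a point on each positive half-axis) then gives d ∣ r
-- and d ∣ s; so in such a configuration all solutions lie on the axes. For fixed r a^x and c at
-- most two values s b^y occur, the larger being r a^x + c; this pins down the axis points, and the
-- resulting equations only admit the families of (3,3,2,1,1), (2,2,3,1,1) and (2,2,5,1,3).

open import Defs
open import Data.Nat using (ℕ; _<_)
open import Data.Nat.GCD using (gcd)
open import Data.Product using (_×_; _,_; ∃; ∃-syntax; proj₁; proj₂)
open import Data.List using (List; _∷_)
open import Data.List.Relation.Unary.All using (All)
open import Data.List.Relation.Unary.Any using (Any)
open import Data.List.Relation.Binary.Permutation.Propositional using (_↭_)
open import Relation.Binary.PropositionalEquality using (_≡_)

open import Data.Nat using (zero; suc; _+_; _*_; _^_; _∸_; _≤_; z≤n; s≤s; >-nonZero; _≟_; _≤?_)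
open import Data.Nat.Properties
open import Data.Nat.Divisibility
  using (_∣_; divides; _∣?_; ∣-refl; ∣⇒≤; ∣1⇒≡1; ∣m∣n⇒∣m+n; ∣m+n∣m⇒∣n; ∣m⇒∣m*n; ∣n⇒∣m*n)
open import Data.Nat.GCD using (gcd[m,n]∣m; gcd[m,n]∣n)
open import Data.Nat.Induction using (<-rec)
open import Data.Nat.Tactic.RingSolver using (solve-∀)
open import Data.Integer as ℤ using (ℤ; +_; -[1+_])
import Data.Integer.Properties as ℤP
import Data.Integer.Tactic.RingSolver as ℤ-Solver
open import Data.Fin as Fin using (Fin; toℕ; fromℕ<)
open import Data.Fin.Properties using (all?; toℕ-fromℕ<)
open import Data.Product using (swap)
open import Data.Product.Properties using (≡-dec)
open import Data.Sum as Sum using (_⊎_; inj₁; inj₂)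
open import Data.Empty using (⊥; ⊥-elim)
open import Data.List using ([]; length; map; lookup)
open import Data.List.Properties using (length-map; map-∘; map-id)
open import Data.List.Relation.Unary.All as All using ([]; _∷_)
import Data.List.Relation.Unary.All.Properties as All
open import Data.List.Relation.Unary.Any as Any using (here; there)
import Data.List.Relation.Unary.Any.Properties as Any
open import Data.List.Relation.Unary.AllPairs using (_∷_)
open import Data.List.Relation.Unary.Unique.Propositional using (Unique)
import Data.List.Relation.Unary.Unique.Propositional.Properties as Unique
open import Data.List.Membership.Propositional using (_∈_; find)
open import Data.List.Membership.Propositional.Properties using (∈-map⁺)
open import Data.List.Relation.Binary.Permutation.Propositional using (↭-refl; ↭-prep; ↭-swap; ↭-trans)
open import Function using (_∘_; id)
open import Relation.Binary using (DecidableEquality; tri<; tri≈; tri>)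
open import Relation.Binary.PropositionalEquality
  using (_≢_; refl; sym; trans; cong; cong₂; subst; subst₂; module ≡-Reasoning)
open import Relation.Nullary using (¬_; Dec; yes; no)
open import Relation.Nullary.Decidable using (True; toWitness; _→-dec_; _×-dec_; _⊎-dec_)

private
  variable
    m n k R S C S′ A B : ℕ

-- ±R ± S = C with the sign pattern (−,−) left out, as it never gives C > 0.
data SignedSum (R S C : ℕ) : Set where
  plus   : R + S ≡ C → SignedSum R S C
  minusˡ : R ≡ S + C → SignedSum R S C
  minusʳ : S ≡ R + C → SignedSum R S C

signedSum-comm : SignedSum R S C → SignedSum S R C
signedSum-comm {R} {S} (plus e) = plus (trans (+-comm S R) e)
signedSum-comm (minusˡ e) = minusʳ e
signedSum-comm (minusʳ e) = minusˡ e

signedSum-≤ : SignedSum R S C → S ≤ R + C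
signedSum-≤ {R} {S} {C} (plus e) = ≤-trans (m≤n+m S R) (≤-trans (≤-reflexive e) (m≤n+m C R))
signedSum-≤ {R} {S} {C} (minusˡ e) = ≤-trans (m≤m+n S C) (≤-trans (≤-reflexive (sym e)) (m≤m+n R C))
signedSum-≤ (minusʳ e) = ≤-reflexive e

signedSum-cancel : 0 < k → SignedSum (k * R) (k * S) (k * C) → SignedSum R S C
signedSum-cancel {k} {R} {S} {C} 0<k ss = cancel ss
  where
  instance _ = >-nonZero 0<k
  cancel : SignedSum (k * R) (k * S) (k * C) → SignedSum R S C
  cancel (plus e) = plus (*-cancelˡ-≡ _ _ k (trans (*-distribˡ-+ k R S) e))
  cancel (minusˡ e) = minusˡ (*-cancelˡ-≡ _ _ k (trans e (sym (*-distribˡ-+ k S C))))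
  cancel (minusʳ e) = minusʳ (*-cancelˡ-≡ _ _ k (trans e (sym (*-distribˡ-+ k R C))))

∣-signedSum : k ∣ R → k ∣ S → SignedSum R S C → k ∣ C
∣-signedSum k∣R k∣S (plus e) = subst (_ ∣_) e (∣m∣n⇒∣m+n k∣R k∣S)
∣-signedSum k∣R k∣S (minusˡ e) = ∣m+n∣m⇒∣n (subst (_ ∣_) e k∣R) k∣S
∣-signedSum k∣R k∣S (minusʳ e) = ∣m+n∣m⇒∣n (subst (_ ∣_) e k∣S) k∣R

∣-signedSumˡ : k ∣ S → k ∣ C → SignedSum R S C → k ∣ R
∣-signedSumˡ {S = S} {R = R} k∣S k∣C (plus e) = ∣m+n∣m⇒∣n (subst (_ ∣_) (trans (sym e) (+-comm R S)) k∣C) k∣S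
∣-signedSumˡ k∣S k∣C (minusˡ e) = subst (_ ∣_) (sym e) (∣m∣n⇒∣m+n k∣S k∣C)
∣-signedSumˡ {C = C} {R = R} k∣S k∣C (minusʳ e) = ∣m+n∣m⇒∣n (subst (_ ∣_) (trans e (+-comm R C)) k∣S) k∣C

∣-signedSumʳ : k ∣ R → k ∣ C → SignedSum R S C → k ∣ S
∣-signedSumʳ k∣R k∣C = ∣-signedSumˡ k∣R k∣C ∘ signedSum-comm

-- For fixed R and C, the solutions S are |R − C| and R + C, so of two distinct ones the larger is R + C.
signedSum-larger : SignedSum R S C → SignedSum R S′ C → S < S′ → S′ ≡ R + C × (R + S ≡ C ⊎ R ≡ S + C)
signedSum-larger {R} {S} {C} {S′} ss ss′ S<S′ = go ss ss′
  where
  open ≤-Reasoning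
  0<S′ : 0 < S′
  0<S′ = ≤-trans (s≤s z≤n) S<S′
  go : SignedSum R S C → SignedSum R S′ C → S′ ≡ R + C × (R + S ≡ C ⊎ R ≡ S + C)
  go (plus e) (plus e′) = ⊥-elim (<⇒≢ S<S′ (+-cancelˡ-≡ R S S′ (trans e (sym e′))))
  go (plus e) (minusˡ e′) = ⊥-elim (<-irrefl refl (begin-strict
    C <⟨ m<n+m C 0<S′ ⟩ S′ + C ≡⟨ e′ ⟨ R ≤⟨ m≤m+n R S ⟩ R + S ≡⟨ e ⟩ C ∎))
  go (plus e) (minusʳ e′) = e′ , inj₁ e
  go (minusˡ e) (plus e′) = ⊥-elim (<-irrefl refl (begin-strict
    R <⟨ m<m+n R 0<S′ ⟩ R + S′ ≡⟨ e′ ⟩ C ≤⟨ m≤n+m C S ⟩ S + C ≡⟨ e ⟨ R ∎))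
  go (minusˡ e) (minusˡ e′) = ⊥-elim (<⇒≢ S<S′ (+-cancelʳ-≡ C S S′ (trans (sym e) e′)))
  go (minusˡ e) (minusʳ e′) = e′ , inj₂ e
  go (minusʳ e) (plus e′) = ⊥-elim (<-irrefl refl (begin-strict
    S′ ≤⟨ m≤n+m S′ R ⟩ R + S′ ≡⟨ e′ ⟩ C ≤⟨ m≤n+m C R ⟩ R + C ≡⟨ e ⟨ S <⟨ S<S′ ⟩ S′ ∎))
  go (minusʳ e) (minusˡ e′) = ⊥-elim (<-irrefl refl (begin-strict
    S′ ≤⟨ m≤m+n S′ C ⟩ S′ + C ≡⟨ e′ ⟨ R ≤⟨ m≤m+n R C ⟩ R + C ≡⟨ e ⟨ S <⟨ S<S′ ⟩ S′ ∎))
  go (minusʳ e) (minusʳ e′) = ⊥-elim (<⇒≢ S<S′ (trans e (sym e′)))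

plus-forced : 0 < S → 0 < C → (R + S ≡ C ⊎ R ≡ S + C) → (S + R ≡ C ⊎ S ≡ R + C) → R + S ≡ C
plus-forced _ _ (inj₁ e) _ = e
plus-forced {S} {C} {R} 0<S _ (inj₂ e) (inj₁ e′) = ⊥-elim (<-irrefl refl (begin-strict
  C <⟨ m<n+m C 0<S ⟩ S + C ≡⟨ e ⟨ R ≤⟨ m≤n+m R S ⟩ S + R ≡⟨ e′ ⟩ C ∎))
  where open ≤-Reasoning
plus-forced {S} {C} {R} _ 0<C (inj₂ e) (inj₂ e′) = ⊥-elim (<-irrefl refl (begin-strict
  R <⟨ m<m+n R 0<C ⟩ R + C ≡⟨ e′ ⟨ S ≤⟨ m≤m+n S C ⟩ S + C ≡⟨ e ⟨ R ∎))
  where open ≤-Reasoning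

signedSum? : ∀ R S C → Dec (SignedSum R S C)
signedSum? R S C with R + S ≟ C | R ≟ S + C | S ≟ R + C
... | yes e | _ | _ = yes (plus e)
... | no _ | yes e | _ = yes (minusˡ e)
... | no _ | no _ | yes e = yes (minusʳ e)
... | no ¬p | no ¬mˡ | no ¬mʳ = no λ { (plus e) → ¬p e ; (minusˡ e) → ¬mˡ e ; (minusʳ e) → ¬mʳ e }

pos-^ : ∀ a x → (+ a) ℤ.^ x ≡ + (a ^ x)
pos-^ a zero = refl
pos-^ a (suc x) = trans (cong ((+ a) ℤ.*_) (pos-^ a x)) (sym (ℤP.pos-* a (a ^ x)))

i≡i-j+j : ∀ (i j : ℤ) → i ≡ (i ℤ.- j) ℤ.+ j
i≡i-j+j = ℤ-Solver.solve-∀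

+m-+n≡+k⇒m≡n+k : ∀ m n k → + m ℤ.- + n ≡ + k → m ≡ n + k
+m-+n≡+k⇒m≡n+k m n k e = ℤP.+-injective (begin
  + m                   ≡⟨ i≡i-j+j (+ m) (+ n) ⟩
  (+ m ℤ.- + n) ℤ.+ + n ≡⟨ cong (ℤ._+ + n) e ⟩
  + k ℤ.+ + n            ≡⟨ ℤP.pos-+ k n ⟨
  + (k + n)             ≡⟨ cong +_ (+-comm k n) ⟩
  + (n + k)             ∎)
  where open ≡-Reasoning

neg≢pos : 0 < k → ℤ.- (+ n) ≢ + k
neg≢pos {n = zero} () refl
neg≢pos {n = suc n} _ ()

signs⇒signedSum : ∀ {u v} → 0 < C → u ≤ 1 → v ≤ 1 →
  (-[1+ 0 ] ℤ.^ u) ℤ.* + R ℤ.+ (-[1+ 0 ] ℤ.^ v) ℤ.* + S ≡ + C → SignedSum R S C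
signs⇒signedSum {C} {R} {S} {0} {0} _ _ _ e =
  plus (ℤP.+-injective (trans (ℤP.pos-+ R S) (trans (cong₂ ℤ._+_ (sym (ℤP.*-identityˡ (+ R))) (sym (ℤP.*-identityˡ (+ S)))) e)))
signs⇒signedSum {C} {R} {S} {0} {1} _ _ _ e =
  minusˡ (+m-+n≡+k⇒m≡n+k R S C (trans (cong₂ ℤ._+_ (sym (ℤP.*-identityˡ (+ R))) (sym (ℤP.-1*i≡-i (+ S)))) e))
signs⇒signedSum {C} {R} {S} {1} {0} _ _ _ e =
  minusʳ (+m-+n≡+k⇒m≡n+k S R C (trans (ℤP.+-comm (+ S) (ℤ.- + R))
    (trans (cong₂ ℤ._+_ (sym (ℤP.-1*i≡-i (+ R))) (sym (ℤP.*-identityˡ (+ S)))) e)))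
signs⇒signedSum {C} {R} {S} {1} {1} 0<C _ _ e = ⊥-elim (neg≢pos 0<C (begin
  ℤ.- + (R + S)                 ≡⟨ cong ℤ.-_ (ℤP.pos-+ R S) ⟩
  ℤ.- (+ R ℤ.+ + S)             ≡⟨ ℤP.neg-distrib-+ (+ R) (+ S) ⟩
  ℤ.- + R ℤ.+ ℤ.- + S           ≡⟨ cong₂ ℤ._+_ (ℤP.-1*i≡-i (+ R)) (ℤP.-1*i≡-i (+ S)) ⟨
  -[1+ 0 ] ℤ.* + R ℤ.+ -[1+ 0 ] ℤ.* + S ≡⟨ e ⟩
  + C                           ∎))
  where open ≡-Reasoning
signs⇒signedSum {u = suc (suc _)} _ (s≤s ()) _ _
signs⇒signedSum {u = 0} {v = suc (suc _)} _ _ (s≤s ()) _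
signs⇒signedSum {u = 1} {v = suc (suc _)} _ _ (s≤s ()) _

isSolution⇒signedSum : ∀ {a b c r s x y} → 0 < c → IsSolution a b c r s (x , y) →
  SignedSum (r * a ^ x) (s * b ^ y) c
isSolution⇒signedSum {a} {b} {c} {r} {s} {x} {y} 0<c (u , v , u≤1 , v≤1 , e) =
  signs⇒signedSum {u = u} {v = v} 0<c u≤1 v≤1 (trans (cong₂ ℤ._+_ (sym (term u r a x)) (sym (term v s b y))) e)
  where
  term : ∀ u r a x → (-[1+ 0 ] ℤ.^ u) ℤ.* (+ r) ℤ.* ((+ a) ℤ.^ x) ≡ (-[1+ 0 ] ℤ.^ u) ℤ.* + (r * a ^ x)
  term u r a x = trans (ℤP.*-assoc (-[1+ 0 ] ℤ.^ u) (+ r) ((+ a) ℤ.^ x))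
    (cong ((-[1+ 0 ] ℤ.^ u) ℤ.*_) (trans (cong (+ r ℤ.*_) (pos-^ a x)) (sym (ℤP.pos-* r (a ^ x)))))

decideBelow : ∀ {P : ℕ → Set} (P? : ∀ n → Dec (P n)) k
  {_ : True (all? λ (i : Fin k) → P? (toℕ i))} → m < k → P m
decideBelow {P = P} P? k {ok} m<k = subst P (toℕ-fromℕ< m<k) (toWitness ok (fromℕ< m<k))

decideBelow² : ∀ {P : ℕ → ℕ → Set} (P? : ∀ m n → Dec (P m n)) k
  {_ : True (all? λ (i : Fin k) → all? λ (j : Fin k) → P? (toℕ i) (toℕ j))} → m < k → n < k → P m n
decideBelow² {P = P} P? k {ok} m<k n<k =
  subst₂ P (toℕ-fromℕ< m<k) (toℕ-fromℕ< n<k) (toWitness ok (fromℕ< m<k) (fromℕ< n<k))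

factor≤ : m * n ≡ suc k → m ≤ suc k
factor≤ {m} {n} e = ∣⇒≤ (divides n (trans (sym e) (*-comm m n)))

*≡3 : m * n ≡ 3 → (m ≡ 1 × n ≡ 3) ⊎ (m ≡ 3 × n ≡ 1)
*≡3 {m} {n} e = decideBelow² (λ m n → m * n ≟ 3 →-dec ((m ≟ 1 ×-dec n ≟ 3) ⊎-dec (m ≟ 3 ×-dec n ≟ 1)))
  4 (s≤s (factor≤ e)) (s≤s (factor≤ (trans (*-comm n m) e))) e

*≡4 : m * n ≡ 4 → (m ≡ 1 × n ≡ 4) ⊎ (m ≡ 2 × n ≡ 2) ⊎ (m ≡ 4 × n ≡ 1)
*≡4 {m} {n} e =
  decideBelow² (λ m n → m * n ≟ 4 →-dec ((m ≟ 1 ×-dec n ≟ 4) ⊎-dec (m ≟ 2 ×-dec n ≟ 2) ⊎-dec (m ≟ 4 ×-dec n ≟ 1)))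
  5 (s≤s (factor≤ e)) (s≤s (factor≤ (trans (*-comm n m) e))) e

n<b^n : 1 < B → n < B ^ n
n<b^n {n = zero} _ = s≤s z≤n
n<b^n {B} {suc n} 1<B = ≤-<-trans (n<b^n 1<B) (subst (B ^ n <_) (*-comm (B ^ n) B) (m<m*n (B ^ n) B 1<B))
  where instance _ = m^n≢0 B n {{>-nonZero (<-trans (s≤s z≤n) 1<B)}}

1<b^n : 1 < B → 0 < n → 1 < B ^ n
1<b^n {B} 1<B 0<n = ^-monoʳ-< B 1<B 0<n

^-injectiveʳ : 1 < B → B ^ m ≡ B ^ n → m ≡ n
^-injectiveʳ {B} {m} {n} 1<B e with <-cmp m n
... | tri< m<n _ _ = ⊥-elim (<⇒≢ (^-monoʳ-< B 1<B m<n) e)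
... | tri≈ _ m≡n _ = m≡n
... | tri> _ _ n<m = ⊥-elim (<⇒≢ (^-monoʳ-< B 1<B n<m) (sym e))

exponent-bound : ∀ {B n R S C} → 1 < B → B ^ n ≤ S → SignedSum R S C → n < R + C
exponent-bound 1<B B^n≤S ss = <-≤-trans (n<b^n 1<B) (≤-trans B^n≤S (signedSum-≤ ss))

∣^ : k ∣ A → 0 < n → k ∣ A ^ n
∣^ {A = A} {n = suc n} k∣A _ = ∣m⇒∣m*n (A ^ n) k∣A

base≡ : 1 < A → 1 < m → m < A * A → A ^ n ≡ m → A ≡ m
base≡ {n = zero} _ 1<m _ refl = ⊥-elim (<-irrefl refl 1<m)
base≡ {A} {n = suc zero} _ _ _ e = trans (sym (*-identityʳ A)) e
base≡ {A} {m} {suc (suc n)} 1<A _ m<A*A e = ⊥-elim (<-irrefl refl (<-≤-trans m<A*A (begin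
  A * A             ≤⟨ *-monoʳ-≤ A (m≤m*n A (A ^ n)) ⟩
  A * (A * A ^ n)   ≡⟨ e ⟩
  m                 ∎)))
  where
  open ≤-Reasoning
  instance _ = m^n≢0 A n {{>-nonZero (<-trans (s≤s z≤n) 1<A)}}

^≡2 : 1 < A → A ^ n ≡ 2 → A ≡ 2
^≡2 {n = n} 1<A = base≡ {n = n} 1<A (s≤s (s≤s z≤n)) (≤-trans (s≤s (s≤s (s≤s z≤n))) (*-mono-≤ 1<A 1<A))

^≡3 : 1 < A → A ^ n ≡ 3 → A ≡ 3
^≡3 {n = n} 1<A = base≡ {n = n} 1<A (s≤s (s≤s z≤n)) (*-mono-≤ 1<A 1<A)

^≡4 : 1 < A → A ^ n ≡ 4 → A ≡ 2 ⊎ A ≡ 4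
^≡4 {A} {n} 1<A e with A ≤? 2
... | yes A≤2 = inj₁ (≤-antisym A≤2 1<A)
... | no A≰2 =
  inj₂ (base≡ {n = n} 1<A (s≤s (s≤s z≤n)) (≤-trans (s≤s (s≤s (s≤s (s≤s (s≤s z≤n))))) (*-mono-≤ 2<A 2<A)) e)
  where
  2<A : 2 < A
  2<A = ≰⇒> A≰2

∣2⇒≡2 : 1 < B → B ∣ 2 → B ≡ 2
∣2⇒≡2 1<B B∣2 = ≤-antisym (∣⇒≤ B∣2) 1<B

*+2≡*2 : 1 < B → B * m + 2 ≡ B * 2 → B ≡ 2 × m ≡ 1
*+2≡*2 {B} {m} 1<B e with ∣2⇒≡2 1<B (∣m+n∣m⇒∣n (subst (B ∣_) (sym e) (∣m⇒∣m*n 2 ∣-refl)) (∣m⇒∣m*n m ∣-refl))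
... | refl = refl , *-cancelˡ-≡ m 1 2 (+-cancelʳ-≡ 2 (2 * m) 2 e)

*≡2+*2 : 1 < B → B * m ≡ 2 + B * 2 → B ≡ 2 × m ≡ 3
*≡2+*2 {B} {m} 1<B e
  with ∣2⇒≡2 1<B (∣m+n∣m⇒∣n (subst (B ∣_) (trans e (+-comm 2 (B * 2))) (∣m⇒∣m*n m ∣-refl)) (∣m⇒∣m*n 2 ∣-refl))
... | refl = refl , *-cancelˡ-≡ m 3 2 e

m+m≡m*2 : ∀ m → m + m ≡ m * 2
m+m≡m*2 = solve-∀

m+m*2≡m*3 : ∀ m → m + m * 2 ≡ m * 3
m+m*2≡m*3 = solve-∀

m*n≡m*1*n : ∀ m n → m * n ≡ m * 1 * n
m*n≡m*1*n m n = cong (_* n) (sym (*-identityʳ m))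

¬∣2∧∣5 : 1 < k → k ∣ 2 → k ∣ 5 → ⊥
¬∣2∧∣5 1<k k∣2 k∣5 = <-irrefl refl (subst (1 <_) (∣1⇒≡1 (∣m+n∣m⇒∣n k∣5 (∣m∣n⇒∣m+n k∣2 k∣2))) 1<k)

-- With A = 1 + A′ and B = 1 + B′ the equations say r A′ = 2s and s B′ = 2r, so A′ B′ = 4.
origin+axes-arith : ∀ {r s c} → 0 < r → 1 < k → k ∣ A → k ∣ B → 1 < A → 1 < B →
  r + s ≡ c → s * B ≡ r + c → r * A ≡ s + c → A ≡ 3 × B ≡ 3 × r ≡ s
origin+axes-arith {k} {suc A′} {suc B′} {r} {s} {c} 0<r 1<k k∣A k∣B _ _ e eB eA = factorisations (*≡4 A′*B′≡4)
  where
  open ≡-Reasoning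
  rA′≡2s : r * A′ ≡ s + s
  rA′≡2s = +-cancelˡ-≡ r (r * A′) (s + s) (begin
    r + r * A′   ≡⟨ *-suc r A′ ⟨
    r * suc A′   ≡⟨ trans eA (cong (_+_ s) (sym e)) ⟩
    s + (r + s)  ≡⟨ lemma r s ⟩
    r + (s + s)  ∎)
    where
    lemma : ∀ r s → s + (r + s) ≡ r + (s + s)
    lemma = solve-∀
  sB′≡2r : s * B′ ≡ r + r
  sB′≡2r = +-cancelˡ-≡ s (s * B′) (r + r) (begin
    s + s * B′   ≡⟨ *-suc s B′ ⟨
    s * suc B′   ≡⟨ trans eB (cong (_+_ r) (sym e)) ⟩
    r + (r + s)  ≡⟨ lemma r s ⟩
    s + (r + r)  ∎)
    where
    lemma : ∀ r s → r + (r + s) ≡ s + (r + r)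
    lemma = solve-∀
  A′*B′≡4 : A′ * B′ ≡ 4
  A′*B′≡4 = *-cancelˡ-≡ (A′ * B′) 4 r {{>-nonZero 0<r}} (begin
    r * (A′ * B′)     ≡⟨ *-assoc r A′ B′ ⟨
    r * A′ * B′       ≡⟨ cong (_* B′) rA′≡2s ⟩
    (s + s) * B′      ≡⟨ *-distribʳ-+ B′ s s ⟩
    s * B′ + s * B′   ≡⟨ cong₂ _+_ sB′≡2r sB′≡2r ⟩
    (r + r) + (r + r) ≡⟨ lemma r ⟩
    r * 4             ∎)
    where
    lemma : ∀ r → (r + r) + (r + r) ≡ r * 4
    lemma = solve-∀
  factorisations : (A′ ≡ 1 × B′ ≡ 4) ⊎ (A′ ≡ 2 × B′ ≡ 2) ⊎ (A′ ≡ 4 × B′ ≡ 1) →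
    suc A′ ≡ 3 × suc B′ ≡ 3 × r ≡ s
  factorisations (inj₁ (refl , refl)) = ⊥-elim (¬∣2∧∣5 1<k k∣A k∣B)
  factorisations (inj₂ (inj₂ (refl , refl))) = ⊥-elim (¬∣2∧∣5 1<k k∣B k∣A)
  factorisations (inj₂ (inj₁ (refl , refl))) = refl , refl , *-cancelʳ-≡ r s 2 (trans rA′≡2s (m+m≡m*2 s))

-- B E′ A′ + 2 = 2B, so B ∣ 2.
plus-pattern-arith : ∀ {r s A′ E′} → 0 < s → 1 < B →
  s * B * E′ ≡ r + r → r * A′ + s ≡ s * B → B ≡ 2 × E′ * A′ ≡ 1
plus-pattern-arith {B} {r} {s} {A′} {E′} 0<s 1<B sBE′≡2r rA′+s≡sB =
  *+2≡*2 1<B (*-cancelˡ-≡ (B * (E′ * A′) + 2) (B * 2) s {{>-nonZero 0<s}} (begin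
    s * (B * (E′ * A′) + 2)  ≡⟨ lemma s B E′ A′ ⟩
    s * B * E′ * A′ + s * 2  ≡⟨ cong (λ t → t * A′ + s * 2) sBE′≡2r ⟩
    (r + r) * A′ + s * 2     ≡⟨ lemma′ r A′ s ⟩
    (r * A′ + s) * 2         ≡⟨ cong (_* 2) rA′+s≡sB ⟩
    s * B * 2                ≡⟨ *-assoc s B 2 ⟩
    s * (B * 2)              ∎))
  where
  open ≡-Reasoning
  lemma : ∀ s B E′ A′ → s * (B * (E′ * A′) + 2) ≡ s * B * E′ * A′ + s * 2
  lemma = solve-∀
  lemma′ : ∀ r A′ s → (r + r) * A′ + s * 2 ≡ (r * A′ + s) * 2
  lemma′ = solve-∀

-- B E′ A′ = 2 + 2B, so B ∣ 2.
minus-pattern-arith : ∀ {r s A′ E′} → 0 < s → 1 < B →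
  s * B * E′ ≡ r + r → r * A′ ≡ s + s * B → B ≡ 2 × E′ * A′ ≡ 3
minus-pattern-arith {B} {r} {s} {A′} {E′} 0<s 1<B sBE′≡2r rA′≡s+sB =
  *≡2+*2 1<B (*-cancelˡ-≡ (B * (E′ * A′)) (2 + B * 2) s {{>-nonZero 0<s}} (begin
    s * (B * (E′ * A′))        ≡⟨ lemma s B E′ A′ ⟩
    s * B * E′ * A′            ≡⟨ cong (_* A′) sBE′≡2r ⟩
    (r + r) * A′               ≡⟨ *-distribʳ-+ A′ r r ⟩
    r * A′ + r * A′            ≡⟨ cong₂ _+_ rA′≡s+sB rA′≡s+sB ⟩
    (s + s * B) + (s + s * B)  ≡⟨ lemma′ s B ⟩
    s * (2 + B * 2)            ∎))
  where
  open ≡-Reasoning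
  lemma : ∀ s B E′ A′ → s * (B * (E′ * A′)) ≡ s * B * E′ * A′
  lemma = solve-∀
  lemma′ : ∀ s B → (s + s * B) + (s + s * B) ≡ s * (2 + B * 2)
  lemma′ = solve-∀

-- With A = 1 + A′ and E = 1 + E′ one gets s B E′ = 2r; the sign pattern then fixes B = 2 and E′ A′ ∈ {1, 3}.
two-yAxis+xAxis-arith : ∀ {r s c E} → 0 < r → 0 < s → 1 < A → 1 < B → 1 < E →
  c ≡ r + s * B → s * (B * E) ≡ r + c → SignedSum (r * A) s c →
  B ≡ 2 × ((r ≡ s × (A ≡ 2 ⊎ A ≡ 4)) ⊎ (r ≡ s * 3 × A ≡ 2))
two-yAxis+xAxis-arith {suc A′} {B} {r} {s} {c} {suc E′} 0<r 0<s _ 1<B _ ec eE = signs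
  where
  open ≤-Reasoning
  sBE′≡2r : s * B * E′ ≡ r + r
  sBE′≡2r = +-cancelˡ-≡ (s * B) (s * B * E′) (r + r) (begin-equality
    s * B + s * B * E′  ≡⟨ lemma s B E′ ⟩
    s * (B * suc E′)    ≡⟨ trans eE (cong (_+_ r) ec) ⟩
    r + (r + s * B)     ≡⟨ lemma′ r (s * B) ⟩
    s * B + (r + r)     ∎)
    where
    lemma : ∀ s B E′ → s * B + s * B * E′ ≡ s * (B * suc E′)
    lemma = solve-∀
    lemma′ : ∀ r t → r + (r + t) ≡ t + (r + r)
    lemma′ = solve-∀
  r≡sE′ : B ≡ 2 → r ≡ s * E′
  r≡sE′ refl = *-cancelʳ-≡ r (s * E′) 2 (trans (sym (m+m≡m*2 r)) (trans (sym sBE′≡2r) (lemma s E′)))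
    where
    lemma : ∀ s E′ → s * 2 * E′ ≡ s * E′ * 2
    lemma = solve-∀
  signs : SignedSum (r * suc A′) s c → B ≡ 2 × ((r ≡ s × (suc A′ ≡ 2 ⊎ suc A′ ≡ 4)) ⊎ (r ≡ s * 3 × suc A′ ≡ 2))
  signs (plus e) with plus-pattern-arith {r = r} 0<s 1<B sBE′≡2r (+-cancelˡ-≡ r (r * A′ + s) (s * B) (begin-equality
      r + (r * A′ + s)  ≡⟨ +-assoc r (r * A′) s ⟨
      r + r * A′ + s    ≡⟨ cong (_+ s) (*-suc r A′) ⟨
      r * suc A′ + s    ≡⟨ trans e ec ⟩
      r + s * B         ∎))
  ... | B≡2 , E′A′≡1 = B≡2 , inj₁ (trans (r≡sE′ B≡2) (trans (cong (s *_) (m*n≡1⇒m≡1 E′ A′ E′A′≡1)) (*-identityʳ s)) ,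
                                   inj₁ (cong suc (m*n≡1⇒n≡1 E′ A′ E′A′≡1)))
  signs (minusˡ e) with minus-pattern-arith {r = r} 0<s 1<B sBE′≡2r (+-cancelˡ-≡ r (r * A′) (s + s * B) (begin-equality
      r + r * A′       ≡⟨ *-suc r A′ ⟨
      r * suc A′       ≡⟨ trans e (cong (_+_ s) ec) ⟩
      s + (r + s * B)  ≡⟨ lemma r s (s * B) ⟩
      r + (s + s * B)  ∎))
    where
    lemma : ∀ r s t → s + (r + t) ≡ r + (s + t)
    lemma = solve-∀
  ... | B≡2 , E′A′≡3 with *≡3 E′A′≡3
  ...   | inj₁ (E′≡1 , A′≡3) = B≡2 , inj₁ (trans (r≡sE′ B≡2) (trans (cong (s *_) E′≡1) (*-identityʳ s)) , inj₂ (cong suc A′≡3))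
  ...   | inj₂ (E′≡3 , A′≡1) = B≡2 , inj₂ (trans (r≡sE′ B≡2) (cong (s *_) E′≡3) , cong suc A′≡1)
  signs (minusʳ e) = ⊥-elim (<-irrefl refl (begin-strict
    s                 ≤⟨ m≤m*n s B ⟩
    s * B             <⟨ m<n+m (s * B) 0<r ⟩
    r + s * B         ≡⟨ ec ⟨
    c                 ≤⟨ m≤n+m c (r * suc A′) ⟩
    r * suc A′ + c    ≡⟨ e ⟨
    s                 ∎))
    where
    instance _ = >-nonZero (<-trans (s≤s z≤n) 1<B)

_≟ᴾ_ : DecidableEquality Pair
_≟ᴾ_ = ≡-dec _≟_ _≟_

open import Data.List.Membership.DecPropositional _≟ᴾ_ using (_∈?_)

one-of : ∀ {A : Set} → DecidableEquality A → ∀ {v w : A} → v ≢ w → ∀ e → v ≢ e ⊎ w ≢ e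
one-of _≟_ {v} v≢w e with v ≟ e
... | no v≢e = inj₁ v≢e
... | yes refl = inj₂ (v≢w ∘ sym)

third : ∀ {A : Set} {L : List A} → DecidableEquality A → Unique L → 3 ≤ length L →
  ∀ e₁ e₂ → ∃[ e ] (e ∈ L × e ≢ e₁ × e ≢ e₂)
third {L = u ∷ v ∷ w ∷ _} _≟_ ((u≢v ∷ u≢w ∷ _) ∷ (v≢w ∷ _) ∷ _) _ e₁ e₂ with u ≟ e₁ | u ≟ e₂
... | no u≢e₁ | no u≢e₂ = u , here refl , u≢e₁ , u≢e₂
... | yes refl | _ = Sum.[ (λ v≢e₂ → v , there (here refl) , u≢v ∘ sym , v≢e₂)
                         , (λ w≢e₂ → w , there (there (here refl)) , u≢w ∘ sym , w≢e₂) ]′ (one-of _≟_ v≢w e₂)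
... | no _ | yes refl = Sum.[ (λ v≢e₁ → v , there (here refl) , v≢e₁ , u≢v ∘ sym)
                            , (λ w≢e₁ → w , there (there (here refl)) , w≢e₁ , u≢w ∘ sym) ]′ (one-of _≟_ v≢w e₁)
third {L = []} _ _ ()
third {L = _ ∷ []} _ _ (s≤s ())
third {L = _ ∷ _ ∷ []} _ _ (s≤s (s≤s ()))

extract : ∀ {A : Set} {P : A → Set} {z : A} {L : List A} → Unique L → z ∈ L →
  All (λ e → e ≢ z → P e) L → ∃[ rest ] (L ↭ z ∷ rest × All P rest)
extract (z∉ ∷ _) (here refl) (_ ∷ ps) = _ , ↭-refl , All.zipWith (λ (p , z≢e) → p (z≢e ∘ sym)) (ps , z∉)
extract {L = u ∷ _} (u∉ ∷ unique) (there z∈) (p ∷ ps) with extract unique z∈ ps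
... | rest , L↭ , all = u ∷ rest , ↭-trans (↭-prep u L↭) (↭-swap u _ ↭-refl) , p (All.lookup u∉ z∈) ∷ all

associate-involutive : ∀ U → associate (associate U) ≡ U
associate-involutive (tuple a b c r s ps) = cong (tuple a b c r s) (trans (sym (map-∘ ps)) (map-id ps))

sameFamily-associate : ∀ T U → SameFamily (associate T) U → SameFamily T (associate U)
sameFamily-associate T U (a~a , b~b , len , p , q , 0<p , 0<q , e , proportional) =
  b~b , a~a , trans (sym (length-map swap (pairs T))) (trans len (sym (length-map swap (pairs U)))) ,
  p , q , 0<p , 0<q , e ,
  All.map (λ any → Any.map⁺ (Any.map swap any)) (All.map⁻ proportional)

notExceptional-associate : ∀ T → NotExceptional T → NotExceptional (associate T)
notExceptional-associate T ne E E∈ U sub =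
  (λ sf → proj₂ (ne E E∈ U sub) (sameFamily-associate T U sf)) ,
  (λ sf → proj₁ (ne E E∈ U sub) (subst (SameFamily T) (associate-involutive U) (sameFamily-associate T (associate U) sf)))

sameFamily-scale : ∀ {a b c r s L} k U → 0 < k → SameFamily (tuple a b c r s L) U →
  SameFamily (tuple a b (c * k) (r * k) (s * k) L) U
sameFamily-scale {c = c} {r} {s} k U 0<k (a~a , b~b , len , p , q , 0<p , 0<q , e , proportional) =
  a~a , b~b , len , p , q * k , 0<p , *-mono-< 0<q 0<k , scale-c ,
  All.map (Any.map (λ (eʳ , eˢ) → scale eʳ , scale eˢ)) proportional
  where
  scale-c : p * (c * k) ≡ q * k * Tuple.c U
  scale-c = trans (sym (*-assoc p c k)) (trans (cong (_* k) e) (lemma q (Tuple.c U) k))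
    where
    lemma : ∀ q w k → q * w * k ≡ q * k * w
    lemma = solve-∀
  scale : ∀ {t u w v} → p * t * u ≡ q * w * v → p * (t * k) * u ≡ q * k * w * v
  scale {t} {u} {w} {v} e = trans (lemma p t k u) (trans (cong (_* k) e) (lemma′ q w v k))
    where
    lemma : ∀ p t k u → p * (t * k) * u ≡ p * t * u * k
    lemma = solve-∀
    lemma′ : ∀ q w v k → q * w * v * k ≡ q * k * w * v
    lemma′ = solve-∀

notExceptional-unscale : ∀ {a b c r s L} k → 0 < k → NotExceptional (tuple a b (c * k) (r * k) (s * k) L) →
  NotExceptional (tuple a b c r s L)
notExceptional-unscale k 0<k ne E E∈ U sub =
  (λ sf → proj₁ (ne E E∈ U sub) (sameFamily-scale k U 0<k sf)) ,
  (λ sf → proj₂ (ne E E∈ U sub) (sameFamily-scale k (associate U) 0<k sf))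

OnAxes : List Pair → Set
OnAxes = All (λ e → proj₁ e ≡ 0 ⊎ proj₂ e ≡ 0)

record SolutionSet (d a b c r s : ℕ) (L : List Pair) : Set where
  field
    1<a : 1 < a
    1<b : 1 < b
    0<c : 0 < c
    0<r : 0 < r
    0<s : 0 < s
    unique : Unique L
    3≤length : 3 ≤ length L
    solutions : All (λ e → SignedSum (r * a ^ proj₁ e) (s * b ^ proj₂ e) c) L
    notExceptional : NotExceptional (tuple a b c r s L)
    1<d : 1 < d
    d∣a : d ∣ a
    d∣b : d ∣ b

module _ {d a b c r s : ℕ} {L : List Pair} (S : SolutionSet d a b c r s L) where
  open SolutionSet S

  solution : ∀ {x y} → (x , y) ∈ L → SignedSum (r * a ^ x) (s * b ^ y) c
  solution = All.lookup solutions

  origin-solution : (0 , 0) ∈ L → SignedSum r s c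
  origin-solution o = subst₂ (λ R S → SignedSum R S c) (*-identityʳ r) (*-identityʳ s) (solution o)

  yAxis-solution : ∀ {y} → (0 , y) ∈ L → SignedSum r (s * b ^ y) c
  yAxis-solution p = subst (λ R → SignedSum R _ c) (*-identityʳ r) (solution p)

  xAxis-solution : ∀ {x} → (x , 0) ∈ L → SignedSum (r * a ^ x) s c
  xAxis-solution p = subst (λ S → SignedSum _ S c) (*-identityʳ s) (solution p)

  r<r*a^ : ∀ {x} → 0 < x → r < r * a ^ x
  r<r*a^ 0<x = m<m*n r _ {{>-nonZero 0<r}} (1<b^n 1<a 0<x)

  s<s*b^ : ∀ {y} → 0 < y → s < s * b ^ y
  s<s*b^ 0<y = m<m*n s _ {{>-nonZero 0<s}} (1<b^n 1<b 0<y)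

  swapped : SolutionSet d b a c s r (map swap L)
  swapped = record
    { 1<a = 1<b ; 1<b = 1<a ; 0<c = 0<c ; 0<r = 0<s ; 0<s = 0<r
    ; unique = Unique.map⁺ (cong swap) unique
    ; 3≤length = subst (3 ≤_) (sym (length-map swap L)) 3≤length
    ; solutions = All.map⁺ (All.map signedSum-comm solutions)
    ; notExceptional = notExceptional-associate (tuple a b c r s L) notExceptional
    ; 1<d = 1<d ; d∣a = d∣b ; d∣b = d∣a
    }

  yAxis⇒∣r : ∀ {y} → d ∣ c → (0 , y) ∈ L → 0 < y → d ∣ r
  yAxis⇒∣r d∣c p 0<y = ∣-signedSumˡ (∣n⇒∣m*n s (∣^ d∣b 0<y)) d∣c (yAxis-solution p)

  origin⇒∣s : d ∣ c → d ∣ r → (0 , 0) ∈ L → d ∣ s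
  origin⇒∣s d∣c d∣r o = ∣-signedSumʳ d∣r d∣c (origin-solution o)

  onAxes : (d ∣ c → d ∣ r × d ∣ s) → ¬ (d ∣ r × d ∣ s) → OnAxes L
  onAxes forced coprime = All.tabulate on-axis
    where
    on-axis : ∀ {e} → e ∈ L → proj₁ e ≡ 0 ⊎ proj₂ e ≡ 0
    on-axis {zero , _} _ = inj₁ refl
    on-axis {suc _ , zero} _ = inj₂ refl
    on-axis {suc x , suc y} p = ⊥-elim (coprime (forced (∣-signedSum
      (∣n⇒∣m*n r (∣^ {n = suc x} d∣a (s≤s z≤n))) (∣n⇒∣m*n s (∣^ {n = suc y} d∣b (s≤s z≤n))) (solution p))))

∣r∧∣s⇒∣c : ∀ {d a b c r s L} → SolutionSet d a b c r s L → d ∣ r → d ∣ s → d ∣ c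
∣r∧∣s⇒∣c {L = []} S _ _ with SolutionSet.3≤length S
... | ()
∣r∧∣s⇒∣c {a = a} {b} {L = (x , y) ∷ _} S d∣r d∣s =
  ∣-signedSum (∣m⇒∣m*n (a ^ x) d∣r) (∣m⇒∣m*n (b ^ y) d∣s) (solution S (here refl))

∈-swap : ∀ {L : List Pair} {x y} → (x , y) ∈ L → (y , x) ∈ map swap L
∈-swap = ∈-map⁺ swap

onAxes-swap : ∀ {L} → OnAxes L → OnAxes (map swap L)
onAxes-swap axes = All.map⁺ (All.map Sum.swap axes)

off-axes : ∀ {L x y} → OnAxes L → (suc x , suc y) ∈ L → ⊥
off-axes axes p = Sum.[ (λ ()) , (λ ()) ]′ (All.lookup axes p)

divided : ∀ {d a b c r s L} → SolutionSet d a b (c * d) (r * d) (s * d) L → SolutionSet d a b c r s L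
divided {d} {a} {b} {c} {r} {s} {L} S = record
  { 1<a = 1<a ; 1<b = 1<b ; 0<c = 0<*ˡ 0<c ; 0<r = 0<*ˡ 0<r ; 0<s = 0<*ˡ 0<s
  ; unique = unique ; 3≤length = 3≤length
  ; solutions = All.map (λ {(x , y)} → signedSum-cancel 0<d ∘ subst₃ (rearrange r (a ^ x)) (rearrange s (b ^ y)) (*-comm c d)) solutions
  ; notExceptional = notExceptional-unscale d 0<d notExceptional
  ; 1<d = 1<d ; d∣a = d∣a ; d∣b = d∣b
  }
  where
  open SolutionSet S
  0<d : 0 < d
  0<d = <-trans (s≤s z≤n) 1<d
  0<*ˡ : ∀ {m} → 0 < m * d → 0 < m
  0<*ˡ {suc _} _ = s≤s z≤n
  rearrange : ∀ t u → t * d * u ≡ d * (t * u)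
  rearrange t u = trans (cong (_* u) (*-comm t d)) (*-assoc d t u)
  subst₃ : ∀ {R R′ S S′ C C′} → R ≡ R′ → S ≡ S′ → C ≡ C′ → SignedSum R S C → SignedSum R′ S′ C′
  subst₃ refl refl refl ss = ss

descent : ∀ {d a b L} → (∀ {c r s} → SolutionSet d a b c r s L → ¬ (d ∣ r × d ∣ s) → ⊥) →
  ∀ {c r s} → SolutionSet d a b c r s L → ⊥
descent {d} {a} {b} {L} coprime {c} {r} {s} = <-rec P step r c s
  where
  P : ℕ → Set
  P r = ∀ c s → SolutionSet d a b c r s L → ⊥
  step : ∀ r → (∀ {r′} → r′ < r → P r′) → P r
  step r rec c s S with d ∣? r | d ∣? s
  ... | no d∤r | _ = coprime S (d∤r ∘ proj₁)
  ... | yes _ | no d∤s = coprime S (d∤s ∘ proj₂)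
  ... | yes d∣r@(divides r′ refl) | yes d∣s@(divides s′ refl) with ∣r∧∣s⇒∣c S d∣r d∣s
  ...   | divides c′ refl = rec r′<r′*d c′ s′ (divided S)
    where
    open SolutionSet S
    r′<r′*d : r′ < r′ * d
    r′<r′*d = m<m*n r′ d {{m*n≢0⇒m≢0 r′ {{>-nonZero 0<r}}}} 1<d

exceptional-family⇒⊥ : ∀ {d a b c r s L E} → SolutionSet d a b c r s L → E ∈ exceptional →
  All (IsSolution (Tuple.a E) (Tuple.b E) (Tuple.c E) (Tuple.r E) (Tuple.s E)) (pairs E) →
  (f : Pair → Pair) → (∀ {e e′} → f e ≡ f e′ → e ≡ e′) → (∀ {e} → e ∈ L → f e ∈ pairs E) →
  PowersOfOne a (Tuple.a E) → PowersOfOne b (Tuple.b E) → ∀ k → 0 < k → c ≡ k * Tuple.c E →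
  (∀ {x y} → (x , y) ∈ L → r * a ^ x ≡ k * Tuple.r E * Tuple.a E ^ proj₁ (f (x , y))
                         × s * b ^ y ≡ k * Tuple.s E * Tuple.b E ^ proj₂ (f (x , y))) → ⊥
exceptional-family⇒⊥ {a = a} {b} {c} {r} {s} {L} {E} S E∈ E-solutions f f-injective f∈ a~ b~ k 0<k c≡ proportional =
  proj₁ (notExceptional E E∈ U (refl , refl , refl , refl , refl , U-solutions , All.map⁺ (All.tabulate f∈))) family
  where
  open SolutionSet S
  U : Tuple
  U = record E { pairs = map f L }
  U-solutions : IsSetOfSolutions U
  U-solutions = Unique.map⁺ f-injective unique , subst (3 ≤_) (sym (length-map f L)) 3≤length ,
    All.map⁺ (All.tabulate (All.lookup E-solutions ∘ f∈))
  family : SameFamily (tuple a b c r s L) U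
  family = a~ , b~ , sym (length-map f L) , 1 , k , s≤s z≤n , 0<k , trans (*-identityˡ c) c≡ ,
    All.tabulate (λ {(x , y)} p → Any.map⁺ (Any.map (λ { refl → unit-scaled p }) p))
    where
    unit-scaled : ∀ {x y} → (x , y) ∈ L →
      1 * r * a ^ x ≡ k * Tuple.r E * Tuple.a E ^ proj₁ (f (x , y)) × 1 * s * b ^ y ≡ k * Tuple.s E * Tuple.b E ^ proj₂ (f (x , y))
    unit-scaled p = trans (cong (_* _) (*-identityˡ r)) (proj₁ (proportional p)) ,
                    trans (cong (_* _) (*-identityˡ s)) (proj₂ (proportional p))

E₁ E₃ E₄ : Tuple
E₁ = lookup exceptional Fin.zero
E₃ = lookup exceptional (Fin.suc (Fin.suc Fin.zero))
E₄ = lookup exceptional (Fin.suc (Fin.suc (Fin.suc Fin.zero)))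

E₁-member : ∀ {x y} → x ≡ 0 ⊎ y ≡ 0 → SignedSum (3 ^ x) (3 ^ y) 2 → (x , y) ∈ pairs E₁
E₁-member (inj₁ refl) ss = decideBelow (λ y → signedSum? 1 (3 ^ y) 2 →-dec (0 , y) ∈? pairs E₁) 3
  (exponent-bound (s≤s (s≤s z≤n)) ≤-refl ss) ss
E₁-member (inj₂ refl) ss = decideBelow (λ x → signedSum? (3 ^ x) 1 2 →-dec (x , 0) ∈? pairs E₁) 3
  (exponent-bound (s≤s (s≤s z≤n)) ≤-refl (signedSum-comm ss)) ss

E₃-member : ∀ {x y} → x ≡ 0 ⊎ y ≡ 0 → SignedSum (2 ^ x) (3 * 2 ^ y) 5 → (x , y) ∈ pairs E₃
E₃-member (inj₁ refl) ss = decideBelow (λ y → signedSum? 1 (3 * 2 ^ y) 5 →-dec (0 , y) ∈? pairs E₃) 6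
  (exponent-bound (s≤s (s≤s z≤n)) (m≤n*m _ 3) ss) ss
E₃-member (inj₂ refl) ss = decideBelow (λ x → signedSum? (2 ^ x) 3 5 →-dec (x , 0) ∈? pairs E₃) 8
  (exponent-bound (s≤s (s≤s z≤n)) ≤-refl (signedSum-comm ss)) ss

E₄-member : ∀ {x y} → x ≡ 0 ⊎ y ≡ 0 → SignedSum (2 ^ x) (2 ^ y) 3 → (x , y) ∈ pairs E₄
E₄-member (inj₁ refl) ss = decideBelow (λ y → signedSum? 1 (2 ^ y) 3 →-dec (0 , y) ∈? pairs E₄) 4
  (exponent-bound (s≤s (s≤s z≤n)) ≤-refl ss) ss
E₄-member (inj₂ refl) ss = decideBelow (λ x → signedSum? (2 ^ x) 1 3 →-dec (x , 0) ∈? pairs E₄) 4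
  (exponent-bound (s≤s (s≤s z≤n)) ≤-refl (signedSum-comm ss)) ss

E₄-member-squared : ∀ {x y} → x ≡ 0 ⊎ y ≡ 0 → SignedSum (4 ^ x) (2 ^ y) 3 → (2 * x , y) ∈ pairs E₄
E₄-member-squared (inj₁ refl) = E₄-member (inj₁ refl)
E₄-member-squared {x} (inj₂ refl) ss = decideBelow {m = x} (λ x → signedSum? (4 ^ x) 1 3 →-dec (2 * x , 0) ∈? pairs E₄) 4
  (exponent-bound (s≤s (s≤s z≤n)) ≤-refl (signedSum-comm ss)) ss

E₁-solutions : All (IsSolution 3 3 2 1 1) (pairs E₁)
E₁-solutions = (0 , 0 , z≤n , z≤n , refl) ∷ (1 , 0 , s≤s z≤n , z≤n , refl) ∷ (0 , 1 , z≤n , s≤s z≤n , refl) ∷ []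

E₃-solutions : All (IsSolution 2 2 5 1 3) (pairs E₃)
E₃-solutions = (1 , 0 , s≤s z≤n , z≤n , refl) ∷ (0 , 0 , z≤n , z≤n , refl) ∷ (0 , 1 , z≤n , s≤s z≤n , refl) ∷ []

E₄-solutions : All (IsSolution 2 2 3 1 1) (pairs E₄)
E₄-solutions = (0 , 0 , z≤n , z≤n , refl) ∷ (1 , 0 , s≤s z≤n , z≤n , refl)
             ∷ (0 , 0 , z≤n , z≤n , refl) ∷ (0 , 1 , z≤n , s≤s z≤n , refl) ∷ []

E₁-family : ∀ {d a b c r s L} → SolutionSet d a b c r s L → OnAxes L → a ≡ 3 → b ≡ 3 → r ≡ s → c ≡ r + s → ⊥
E₁-family {s = s} {L} S axes refl refl refl refl =
  exceptional-family⇒⊥ S (here refl) E₁-solutions id id member (3 , 1 , 1 , refl , refl) (3 , 1 , 1 , refl , refl)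
    s 0<s (m+m≡m*2 s) (λ {x} {y} _ → m*n≡m*1*n s (3 ^ x) , m*n≡m*1*n s (3 ^ y))
  where
  open SolutionSet S
  member : ∀ {e} → e ∈ L → e ∈ pairs E₁
  member p = E₁-member (All.lookup axes p) (signedSum-cancel 0<s (subst (SignedSum _ _) (m+m≡m*2 s) (solution S p)))

E₃-family : ∀ {d a b c r s L} → SolutionSet d a b c r s L → OnAxes L → a ≡ 2 → b ≡ 2 → s ≡ r * 3 → c ≡ s + r * 2 → ⊥
E₃-family {r = r} {L = L} S axes refl refl refl refl =
  exceptional-family⇒⊥ S (there (there (here refl))) E₃-solutions id id member (2 , 1 , 1 , refl , refl) (2 , 1 , 1 , refl , refl)
    r 0<r (lemma r) (λ {x} _ → m*n≡m*1*n r (2 ^ x) , refl)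
  where
  open SolutionSet S
  lemma : ∀ r → r * 3 + r * 2 ≡ r * 5
  lemma = solve-∀
  member : ∀ {e} → e ∈ L → e ∈ pairs E₃
  member {x , y} p = E₃-member (All.lookup axes p)
    (signedSum-cancel 0<r (subst₂ (SignedSum _) (*-assoc r 3 (2 ^ y)) (lemma r) (solution S p)))

E₄-family : ∀ {d a b c r s L} → SolutionSet d a b c r s L → OnAxes L →
  a ≡ 2 ⊎ a ≡ 4 → b ≡ 2 → r ≡ s → c ≡ r + s * 2 → ⊥
E₄-family {s = s} {L} S axes (inj₁ refl) refl refl refl =
  exceptional-family⇒⊥ S (there (there (there (here refl)))) E₄-solutions id id member (2 , 1 , 1 , refl , refl) (2 , 1 , 1 , refl , refl)
    s 0<s (m+m*2≡m*3 s) (λ {x} {y} _ → m*n≡m*1*n s (2 ^ x) , m*n≡m*1*n s (2 ^ y))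
  where
  open SolutionSet S
  member : ∀ {e} → e ∈ L → e ∈ pairs E₄
  member p = E₄-member (All.lookup axes p) (signedSum-cancel 0<s (subst (SignedSum _ _) (m+m*2≡m*3 s) (solution S p)))
E₄-family {s = s} {L} S axes (inj₂ refl) refl refl refl =
  exceptional-family⇒⊥ S (there (there (there (here refl)))) E₄-solutions double double-injective member
    (2 , 2 , 1 , refl , refl) (2 , 1 , 1 , refl , refl) s 0<s (m+m*2≡m*3 s)
    (λ {x} {y} _ → trans (m*n≡m*1*n s (4 ^ x)) (cong (s * 1 *_) (^-*-assoc 2 2 x)) , m*n≡m*1*n s (2 ^ y))
  where
  open SolutionSet S
  double : Pair → Pair
  double (x , y) = 2 * x , y
  double-injective : ∀ {e e′} → double e ≡ double e′ → e ≡ e′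
  double-injective {x , y} {x′ , y′} e = cong₂ _,_ (*-cancelˡ-≡ x x′ 2 (cong proj₁ e)) (cong proj₂ e)
  member : ∀ {e} → e ∈ L → double e ∈ pairs E₄
  member p = E₄-member-squared (All.lookup axes p) (signedSum-cancel 0<s (subst (SignedSum _ _) (m+m*2≡m*3 s) (solution S p)))

¬origin+yAxis-onAxes : ∀ {d a b c r s L y} → SolutionSet d a b c r s L → OnAxes L →
  (0 , 0) ∈ L → (0 , y) ∈ L → 0 < y → ⊥
¬origin+yAxis-onAxes {a = a} {b} {c} {r} {s} {L} {y} S axes o p 0<y =
  third-point (third _≟ᴾ_ unique 3≤length (0 , 0) (0 , y))
  where
  open SolutionSet S
  larger₀ : s * b ^ y ≡ r + c × (r + s ≡ c ⊎ r ≡ s + c)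
  larger₀ = signedSum-larger (origin-solution S o) (yAxis-solution S p) (s<s*b^ S 0<y)
  third-point : ∃[ e ] (e ∈ L × e ≢ (0 , 0) × e ≢ (0 , y)) → ⊥
  third-point ((zero , zero) , _ , q≢o , _) = q≢o refl
  third-point ((zero , suc y′) , q , _ , q≢p) = q≢p (cong (0 ,_) (^-injectiveʳ {m = suc y′} 1<b
    (*-cancelˡ-≡ _ _ s {{>-nonZero 0<s}} (trans (proj₁ larger) (sym (proj₁ larger₀))))))
    where
    larger : s * b ^ suc y′ ≡ r + c × (r + s ≡ c ⊎ r ≡ s + c)
    larger = signedSum-larger (origin-solution S o) (yAxis-solution S q) (s<s*b^ S {suc y′} (s≤s z≤n))
  third-point ((suc x′ , zero) , q , _ , _) = in-E₁-family
    (origin+axes-arith 0<r 1<d (∣^ {n = suc x′} d∣a (s≤s z≤n)) (∣^ {n = y} d∣b 0<y) (1<b^n {n = suc x′} 1<a (s≤s z≤n))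
                       (1<b^n 1<b 0<y) r+s≡c (proj₁ larger₀) (proj₁ larger₁))
    where
    larger₁ : r * a ^ suc x′ ≡ s + c × (s + r ≡ c ⊎ s ≡ r + c)
    larger₁ = signedSum-larger (signedSum-comm (origin-solution S o)) (signedSum-comm (xAxis-solution S q)) (r<r*a^ S {suc x′} (s≤s z≤n))
    r+s≡c : r + s ≡ c
    r+s≡c = plus-forced 0<s 0<c (proj₂ larger₀) (proj₂ larger₁)
    in-E₁-family : a ^ suc x′ ≡ 3 × b ^ y ≡ 3 × r ≡ s → ⊥
    in-E₁-family (A≡3 , B≡3 , r≡s) = E₁-family S axes (^≡3 {n = suc x′} 1<a A≡3) (^≡3 {n = y} 1<b B≡3) r≡s (sym r+s≡c)
  third-point ((suc _ , suc _) , q , _ , _) = off-axes axes q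

¬yAxis<yAxis+xAxis-onAxes : ∀ {d a b c r s L x y₁ y₂} → SolutionSet d a b c r s L → OnAxes L →
  (0 , y₁) ∈ L → (0 , y₂) ∈ L → (x , 0) ∈ L → 0 < y₁ → y₁ < y₂ → 0 < x → ⊥
¬yAxis<yAxis+xAxis-onAxes {a = a} {b} {c} {r} {s} {L} {x} {y₁} {y₂} S axes p₁ p₂ q 0<y₁ y₁<y₂ 0<x = lower (proj₂ larger)
  where
  open SolutionSet S
  larger : s * b ^ y₂ ≡ r + c × (r + s * b ^ y₁ ≡ c ⊎ r ≡ s * b ^ y₁ + c)
  larger = signedSum-larger (yAxis-solution S p₁) (yAxis-solution S p₂) (*-monoʳ-< s {{>-nonZero 0<s}} (^-monoʳ-< b 1<b y₁<y₂))
  split : b ^ y₂ ≡ b ^ y₁ * b ^ (y₂ ∸ y₁)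
  split = trans (cong (b ^_) (sym (m+[n∸m]≡n (<⇒≤ y₁<y₂)))) (^-distribˡ-+-* b y₁ (y₂ ∸ y₁))
  lower : r + s * b ^ y₁ ≡ c ⊎ r ≡ s * b ^ y₁ + c → ⊥
  lower (inj₂ r≡) = <-irrefl refl (begin-strict
    r * a ^ x        ≤⟨ signedSum-≤ (signedSum-comm (xAxis-solution S q)) ⟩
    s + c            <⟨ +-monoˡ-< c (s<s*b^ S 0<y₁) ⟩
    s * b ^ y₁ + c   ≡⟨ r≡ ⟨
    r                <⟨ r<r*a^ S 0<x ⟩
    r * a ^ x        ∎)
    where open ≤-Reasoning
  lower (inj₁ c≡) = family (two-yAxis+xAxis-arith 0<r 0<s (1<b^n 1<a 0<x) (1<b^n 1<b 0<y₁) (1<b^n 1<b (m<n⇒0<n∸m y₁<y₂))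
                             (sym c≡) (trans (cong (s *_) (sym split)) (proj₁ larger)) (xAxis-solution S q))
    where
    c≡r+2s : b ^ y₁ ≡ 2 → c ≡ r + s * 2
    c≡r+2s B≡2 = trans (sym c≡) (cong (λ B → r + s * B) B≡2)
    family : b ^ y₁ ≡ 2 × ((r ≡ s × (a ^ x ≡ 2 ⊎ a ^ x ≡ 4)) ⊎ (r ≡ s * 3 × a ^ x ≡ 2)) → ⊥
    family (B≡2 , inj₁ (r≡s , inj₁ A≡2)) =
      E₄-family S axes (inj₁ (^≡2 {n = x} 1<a A≡2)) (^≡2 {n = y₁} 1<b B≡2) r≡s (c≡r+2s B≡2)
    family (B≡2 , inj₁ (r≡s , inj₂ A≡4)) =
      E₄-family S axes (^≡4 {n = x} 1<a A≡4) (^≡2 {n = y₁} 1<b B≡2) r≡s (c≡r+2s B≡2)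
    family (B≡2 , inj₂ (r≡3s , A≡2)) =
      E₃-family (swapped S) (onAxes-swap axes) (^≡2 {n = y₁} 1<b B≡2) (^≡2 {n = x} 1<a A≡2) r≡3s (c≡r+2s B≡2)

¬two-yAxis+xAxis-onAxes : ∀ {d a b c r s L x y₁ y₂} → SolutionSet d a b c r s L → OnAxes L →
  (0 , y₁) ∈ L → (0 , y₂) ∈ L → (x , 0) ∈ L → 0 < y₁ → 0 < y₂ → y₁ ≢ y₂ → 0 < x → ⊥
¬two-yAxis+xAxis-onAxes {y₁ = y₁} {y₂} S axes p₁ p₂ q 0<y₁ 0<y₂ y₁≢y₂ 0<x with <-cmp y₁ y₂
... | tri< y₁<y₂ _ _ = ¬yAxis<yAxis+xAxis-onAxes S axes p₁ p₂ q 0<y₁ y₁<y₂ 0<x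
... | tri≈ _ y₁≡y₂ _ = y₁≢y₂ y₁≡y₂
... | tri> _ _ y₂<y₁ = ¬yAxis<yAxis+xAxis-onAxes S axes p₂ p₁ q 0<y₂ y₂<y₁ 0<x

¬xAxis+yAxis-onAxes : ∀ {d a b c r s L x y} → SolutionSet d a b c r s L → OnAxes L →
  (x , 0) ∈ L → (0 , y) ∈ L → 0 < x → 0 < y → ⊥
¬xAxis+yAxis-onAxes {L = L} {x} {y} S axes p q 0<x 0<y with (0 , 0) ∈? L
... | yes o = ¬origin+yAxis-onAxes S axes o q 0<y
... | no o∉ = third-point (third _≟ᴾ_ (SolutionSet.unique S) (SolutionSet.3≤length S) (x , 0) (0 , y))
  where
  third-point : ∃[ e ] (e ∈ L × e ≢ (x , 0) × e ≢ (0 , y)) → ⊥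
  third-point ((zero , zero) , t , _ , _) = o∉ t
  third-point ((zero , suc _) , t , _ , t≢q) =
    ¬two-yAxis+xAxis-onAxes S axes q t p 0<y (s≤s z≤n) (λ y≡ → t≢q (cong (0 ,_) (sym y≡))) 0<x
  third-point ((suc _ , zero) , t , t≢p , _) =
    ¬two-yAxis+xAxis-onAxes (swapped S) (onAxes-swap axes) (∈-swap p) (∈-swap t) (∈-swap q) 0<x (s≤s z≤n)
      (λ x≡ → t≢p (cong (_, 0) (sym x≡))) 0<y
  third-point ((suc _ , suc _) , t , _ , _) = off-axes axes t

¬origin+yAxis : ∀ {d a b c r s L y} → SolutionSet d a b c r s L → (0 , 0) ∈ L → (0 , y) ∈ L → 0 < y → ⊥
¬origin+yAxis {d} {a} {b} {L = L} S o p 0<y =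
  descent (λ S′ coprime → ¬origin+yAxis-onAxes S′ (onAxes S′ (forced S′) coprime) o p 0<y) S
  where
  forced : ∀ {c r s} → SolutionSet d a b c r s L → d ∣ c → d ∣ r × d ∣ s
  forced S′ d∣c = yAxis⇒∣r S′ d∣c p 0<y , origin⇒∣s S′ d∣c (yAxis⇒∣r S′ d∣c p 0<y) o

¬xAxis+yAxis : ∀ {d a b c r s L x y} → SolutionSet d a b c r s L → (x , 0) ∈ L → (0 , y) ∈ L → 0 < x → 0 < y → ⊥
¬xAxis+yAxis {d} {a} {b} {L = L} S p q 0<x 0<y =
  descent (λ S′ coprime → ¬xAxis+yAxis-onAxes S′ (onAxes S′ (forced S′) coprime) p q 0<x 0<y) S
  where
  forced : ∀ {c r s} → SolutionSet d a b c r s L → d ∣ c → d ∣ r × d ∣ s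
  forced S′ d∣c = yAxis⇒∣r S′ d∣c q 0<y , yAxis⇒∣r (swapped S′) d∣c (∈-swap p) 0<x

toSolutionSet : (T : Tuple) → 1 < a T → 1 < b T → 0 < c T → 0 < r T → 0 < s T →
  IsSetOfSolutions T → 1 < gcd (a T) (b T) → NotExceptional T →
  SolutionSet (gcd (a T) (b T)) (a T) (b T) (c T) (r T) (s T) (pairs T)
toSolutionSet T 1<a 1<b 0<c 0<r 0<s (unique , 3≤length , solutions) 1<gcd notExceptional = record
  { 1<a = 1<a ; 1<b = 1<b ; 0<c = 0<c ; 0<r = 0<r ; 0<s = 0<s
  ; unique = unique ; 3≤length = 3≤length
  ; solutions = All.map (λ {(x , y)} → isSolution⇒signedSum {x = x} {y} 0<c) solutions
  ; notExceptional = notExceptional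
  ; 1<d = 1<gcd ; d∣a = gcd[m,n]∣m (a T) (b T) ; d∣b = gcd[m,n]∣n (a T) (b T)
  }

lemma3 : (T : Tuple) → 1 < a T → 1 < b T → 0 < c T → 0 < r T → 0 < s T →
    IsSetOfSolutions T → 1 < gcd (a T) (b T) →
    Any (λ xy → proj₁ xy ≡ 0) (pairs T) → Any (λ xy → proj₂ xy ≡ 0) (pairs T) →
    NotExceptional T →
    ∃[ rest ] ((pairs T ↭ ((0 , 0) ∷ rest))
      × All (λ xy → (0 < proj₁ xy) × (0 < proj₂ xy)) rest)
lemma3 T 1<a 1<b 0<c 0<r 0<s set 1<gcd some-x≡0 some-y≡0 notExceptional =
  extract (proj₁ set) origin∈ (All.tabulate interior)
  where
  sols : SolutionSet (gcd (a T) (b T)) (a T) (b T) (c T) (r T) (s T) (pairs T)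
  sols = toSolutionSet T 1<a 1<b 0<c 0<r 0<s set 1<gcd notExceptional
  origin∈ : (0 , 0) ∈ pairs T
  origin∈ with find some-x≡0 | find some-y≡0
  ... | (_ , zero) , p , refl | _ = p
  ... | _ | (zero , _) , q , refl = q
  ... | (_ , suc _) , p , refl | (suc _ , _) , q , refl = ⊥-elim (¬xAxis+yAxis sols q p (s≤s z≤n) (s≤s z≤n))
  interior : ∀ {e} → e ∈ pairs T → e ≢ (0 , 0) → 0 < proj₁ e × 0 < proj₂ e
  interior {zero , zero} _ e≢o = ⊥-elim (e≢o refl)
  interior {zero , suc _} p _ = ⊥-elim (¬origin+yAxis sols origin∈ p (s≤s z≤n))
  interior {suc _ , zero} p _ = ⊥-elim (¬origin+yAxis (swapped sols) (∈-swap origin∈) (∈-swap p) (s≤s z≤n))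
  interior {suc _ , suc _} _ _ = s≤s z≤n , s≤s z≤n
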